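{- Let $\mathscr{U}=(U,\mathcal{A},\lambda)$ be a linear reflexive object in a Cartesian closed differential category. Let $S,T$ be differential $\lambda$-terms, $\vec x=x_1,\dots,x_n$ a sequence of distinct variables and $y$ a variable not occurring in $\vec x$, such that $\vec x,y$ is adequate for $S$ and $\vec x$ is adequate for $T$. Then $[\![\frac{\partial S}{\partial y}\cdot T]\!]_{\vec x,y}=[\![S]\!]_{\vec x,y}\star[\![T]\!]_{\vec x}$.
   Context: Cartesian closed differential category: a category with commutative-monoid homsets $(+,0)$ satisfying $(g+h)\circ f=g\circ f+h\circ f$, $0\circ f=0$, with finite products whose projections are additive ($f\circ(g+h)=f\circ g+f\circ h$, $f\circ0=0$) and pairings of additive maps additive, with an operator $D$ sending $f:A\to B$ to $D(f):A\times A\to B$ satisfying (D1) $D(f+g)=D(f)+D(g)$, $D(0)=0$; (D2) $D(f)\circ\langle h+k,v\rangle=D(f)\circ\langle h,v\rangle+D(f)\circ\langle k,v\rangle$, $D(f)\circ\langle0,v\rangle=0$; (D3) $D(\mathrm{Id})=\pi_1$, $D(\pi_1)=\pi_1\circ\pi_1$, $D(\pi_2)=\pi_2\circ\pi_1$; (D4) $D\langle f,g\rangle=\langle D(f),D(g)\rangle$; (D5) $D(f\circ g)=D(f)\circ\langle D(g),g\circ\pi_2\rangle$; (D6) $D(D(f))\circ\langle\langle g,0\rangle,\langle h,k\rangle\rangle=D(f)\circ\langle g,k\rangle$; (D7) $D(D(f))\circ\langle\langle0,h\rangle,\langle g,k\rangle\rangle=D(D(f))\circ\langle\langle0,g\rangle,\langle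 h,k\rangle\rangle$; which is Cartesian closed (exponential $[A\Rightarrow B]$, $\mathrm{ev}$, currying $\Lambda$) with $\Lambda(f+g)=\Lambda(f)+\Lambda(g)$, $\Lambda(0)=0$ and $D(\Lambda(f))=\Lambda(D(f)\circ\langle\pi_1\times0_A,\pi_2\times\mathrm{Id}_A\rangle)$ for $f:C\times A\to B$. $\Lambda^-(h)=\mathrm{ev}\circ(h\times\mathrm{Id})$. $f$ is linear if $D(f)=f\circ\pi_1$. For $f:C\times A\to B$, $g:C\to A$: $f\star g=D(f)\circ\langle\langle0_C,g\circ\pi_1\rangle,\mathrm{Id}_{C\times A}\rangle$. A linear reflexive object is $(U,\mathcal{A},\lambda)$ with $\mathcal{A}:U\to[U\Rightarrow U]$, $\lambda:[U\Rightarrow U]\to U$, $\mathcal{A}\circ\lambda=\mathrm{Id}$, both linear. Differential $\lambda$-terms $S,T::=0\mid s\mid s+T$, simple terms $s,t::=x\mid\lambda x.s\mid sT\mid\mathsf{D}s\cdot t$, modulo $\alpha$-conversion, AC of $+$ with unit $0$, and permutation of the arguments of $\mathsf{D}^ns\cdot(t_1,\dots,t_n)$ ($\mathsf{D}^1s\cdot t=\mathsf{D}s\cdot t$, $\mathsf{D}^{n+1}s\cdot(t,t_1,\dots,t_n)=\mathsf{D}^n(\mathsf{D}s\cdot t)\cdot(t_1,\dots,t_n)$); abbreviations $\lambda x.\sum s_i=\sum\lambda x.s_i$, $(\sum s_i)T=\sum s_iT$, $\mathsf{D}(\sum s_i)\cdot(\sum t_j)=\sum\mathsf{D}s_i\cdot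 t_j$. Differential substitution: $\frac{\partial z}{\partial y}\cdot T=T$ if $z=y$, else $0$; $\frac{\partial(sV)}{\partial y}\cdot T=(\frac{\partial s}{\partial y}\cdot T)V+(\mathsf{D}s\cdot(\frac{\partial V}{\partial y}\cdot T))V$; $\frac{\partial(\lambda z.s)}{\partial y}\cdot T=\lambda z.\frac{\partial s}{\partial y}\cdot T$ ($z\neq y$, $z\notin\mathrm{FV}(T)$); $\frac{\partial(\mathsf{D}^ns\cdot(u_1..u_n))}{\partial y}\cdot T=\mathsf{D}^n(\frac{\partial s}{\partial y}\cdot T)\cdot(u_1..u_n)+\sum_i\mathsf{D}^ns\cdot(u_1,..,\frac{\partial u_i}{\partial y}\cdot T,..,u_n)$; $\frac{\partial0}{\partial y}\cdot T=0$; linear on sums. Interpretation: for distinct variables $\vec x=x_1,\dots,x_n$, $U^{\vec x}=U^{x_1..x_{n-1}}\times U$ (empty: terminal), $\pi^{\vec x}_n=\pi_2$, $\pi^{\vec x}_i=\pi^{x_1..x_{n-1}}_i\circ\pi_1$; $\vec x$ adequate for $S$ if it contains all free variables of $S$. $[\![x_i]\!]_{\vec x}=\pi_i^{\vec x}$; $[\![sT]\!]=\mathrm{ev}\circ\langle\mathcal{A}\circ[\![s]\!],[\![T]\!]\rangle$; $[\![\lambda z.s]\!]_{\vec x}=\lambda\circ\Lambda([\![s]\!]_{\vec x,z})$; $[\![\mathsf{D}^1s\cdot t]\!]=\lambda\circ\Lambda(\Lambda^-(\mathcal{A}\circ[\![s]\!])\star[\![t]\!])$; $[\![\mathsf{D}^{n+1}s\cdot(t_1..t_{n+1})]\!]=\lambda\circ\Lambda(\Lambda^-(\mathcal{A}\circ[\![\mathsf{D}^ns\cdot(t_1..t_n)]\!])\star[\![t_{n+1}]\!])$;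 $[\![0]\!]=0$; $[\![s+S]\!]=[\![s]\!]+[\![S]\!]$. -}

module Defs where

open import Level using (Level; _⊔_) renaming (suc to lsuc)
open import Data.Nat using (ℕ; zero; suc)
open import Data.Fin using (Fin; zero; suc; _≟_)
open import Relation.Binary using (Rel; IsEquivalence)
open import Relation.Nullary using (yes; no)
open import Algebra.Structures using (IsCommutativeMonoid)

record CCDC (o ℓ e : Level) : Set (lsuc (o ⊔ ℓ ⊔ e)) where
  infixr 9 _∘_
  infixl 6 _+_
  infix 4 _≈_
  infixr 7 _×_
  infixr 5 _⇒_
  field
    Obj : Set o
    Hom : Obj → Obj → Set ℓ
    _≈_ : ∀ {A B} → Rel (Hom A B) e
    ≈-isEquivalence : ∀ {A B} → IsEquivalence (_≈_ {A} {B})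
    id  : ∀ {A} → Hom A A
    _∘_ : ∀ {A B C} → Hom B C → Hom A B → Hom A C
    ∘-resp-≈ : ∀ {A B C} {f f' : Hom B C} {g g' : Hom A B} →
               f ≈ f' → g ≈ g' → f ∘ g ≈ f' ∘ g'
    assoc : ∀ {A B C D} (f : Hom C D) (g : Hom B C) (h : Hom A B) →
            (f ∘ g) ∘ h ≈ f ∘ (g ∘ h)
    identityˡ : ∀ {A B} (f : Hom A B) → id ∘ f ≈ f
    identityʳ : ∀ {A B} (f : Hom A B) → f ∘ id ≈ f

    _+_ : ∀ {A B} → Hom A B → Hom A B → Hom A B
    0h  : ∀ {A B} → Hom A B
    +-isCommutativeMonoid : ∀ {A B} → IsCommutativeMonoid (_≈_ {A} {B}) _+_ 0h
    +-∘ : ∀ {A B C} (g h : Hom B C) (f : Hom A B) → (g + h) ∘ f ≈ g ∘ f + h ∘ f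
    0-∘ : ∀ {A B C} (f : Hom A B) → 0h {B} {C} ∘ f ≈ 0h

    ⊤ : Obj
    ! : ∀ {A} → Hom A ⊤
    !-unique : ∀ {A} (f : Hom A ⊤) → f ≈ !
    _×_ : Obj → Obj → Obj
    π₁ : ∀ {A B} → Hom (A × B) A
    π₂ : ∀ {A B} → Hom (A × B) B
    ⟨_,_⟩ : ∀ {C A B} → Hom C A → Hom C B → Hom C (A × B)
    π₁-⟨⟩ : ∀ {C A B} (f : Hom C A) (g : Hom C B) → π₁ ∘ ⟨ f , g ⟩ ≈ f
    π₂-⟨⟩ : ∀ {C A B} (f : Hom C A) (g : Hom C B) → π₂ ∘ ⟨ f , g ⟩ ≈ g
    ⟨⟩-unique : ∀ {C A B} {f : Hom C A} {g : Hom C B} (h : Hom C (A × B)) →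
                π₁ ∘ h ≈ f → π₂ ∘ h ≈ g → h ≈ ⟨ f , g ⟩
    π₁-+ : ∀ {C A B} (g h : Hom C (A × B)) → π₁ ∘ (g + h) ≈ π₁ ∘ g + π₁ ∘ h
    π₁-0 : ∀ {C A B} → π₁ ∘ 0h {C} {A × B} ≈ 0h
    π₂-+ : ∀ {C A B} (g h : Hom C (A × B)) → π₂ ∘ (g + h) ≈ π₂ ∘ g + π₂ ∘ h
    π₂-0 : ∀ {C A B} → π₂ ∘ 0h {C} {A × B} ≈ 0h
    ⟨⟩-additive-+ : ∀ {C A B} (f : Hom C A) (g : Hom C B) →
      (∀ {X} (a b : Hom X C) → f ∘ (a + b) ≈ f ∘ a + f ∘ b) → (∀ {X} → f ∘ 0h {X} ≈ 0h) →
      (∀ {X} (a b : Hom X C) → g ∘ (a + b) ≈ g ∘ a + g ∘ b) → (∀ {X} → g ∘ 0h {X} ≈ 0h) →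
      ∀ {X} (a b : Hom X C) → ⟨ f , g ⟩ ∘ (a + b) ≈ ⟨ f , g ⟩ ∘ a + ⟨ f , g ⟩ ∘ b
    ⟨⟩-additive-0 : ∀ {C A B} (f : Hom C A) (g : Hom C B) →
      (∀ {X} (a b : Hom X C) → f ∘ (a + b) ≈ f ∘ a + f ∘ b) → (∀ {X} → f ∘ 0h {X} ≈ 0h) →
      (∀ {X} (a b : Hom X C) → g ∘ (a + b) ≈ g ∘ a + g ∘ b) → (∀ {X} → g ∘ 0h {X} ≈ 0h) →
      ∀ {X} → ⟨ f , g ⟩ ∘ 0h {X} ≈ 0h

    D : ∀ {A B} → Hom A B → Hom (A × A) B
    D-resp-≈ : ∀ {A B} {f g : Hom A B} → f ≈ g → D f ≈ D g
    D1-+ : ∀ {A B} (f g : Hom A B) → D (f + g) ≈ D f + D g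
    D1-0 : ∀ {A B} → D (0h {A} {B}) ≈ 0h
    D2-+ : ∀ {C A B} (f : Hom A B) (h k v : Hom C A) →
           D f ∘ ⟨ h + k , v ⟩ ≈ D f ∘ ⟨ h , v ⟩ + D f ∘ ⟨ k , v ⟩
    D2-0 : ∀ {C A B} (f : Hom A B) (v : Hom C A) → D f ∘ ⟨ 0h , v ⟩ ≈ 0h
    D3-id : ∀ {A} → D (id {A}) ≈ π₁
    D3-π₁ : ∀ {A B} → D (π₁ {A} {B}) ≈ π₁ ∘ π₁
    D3-π₂ : ∀ {A B} → D (π₂ {A} {B}) ≈ π₂ ∘ π₁
    D4 : ∀ {C A B} (f : Hom C A) (g : Hom C B) → D ⟨ f , g ⟩ ≈ ⟨ D f , D g ⟩
    D5 : ∀ {A B C} (f : Hom B C) (g : Hom A B) → D (f ∘ g) ≈ D f ∘ ⟨ D g , g ∘ π₂ ⟩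
    D6 : ∀ {C A B} (f : Hom A B) (g h k : Hom C A) →
         D (D f) ∘ ⟨ ⟨ g , 0h ⟩ , ⟨ h , k ⟩ ⟩ ≈ D f ∘ ⟨ g , k ⟩
    D7 : ∀ {C A B} (f : Hom A B) (g h k : Hom C A) →
         D (D f) ∘ ⟨ ⟨ 0h , h ⟩ , ⟨ g , k ⟩ ⟩ ≈ D (D f) ∘ ⟨ ⟨ 0h , g ⟩ , ⟨ h , k ⟩ ⟩

    -- Cartesian closure (h × Id written as ⟨ h ∘ π₁ , id ∘ π₂ ⟩)
    _⇒_ : Obj → Obj → Obj
    ev : ∀ {A B} → Hom ((A ⇒ B) × A) B
    Λ  : ∀ {C A B} → Hom (C × A) B → Hom C (A ⇒ B)
    Λ-β : ∀ {C A B} (f : Hom (C × A) B) → ev ∘ ⟨ Λ f ∘ π₁ , id ∘ π₂ ⟩ ≈ f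
    Λ-unique : ∀ {C A B} {f : Hom (C × A) B} (h : Hom C (A ⇒ B)) →
               ev ∘ ⟨ h ∘ π₁ , id ∘ π₂ ⟩ ≈ f → h ≈ Λ f
    Λ-+ : ∀ {C A B} (f g : Hom (C × A) B) → Λ (f + g) ≈ Λ f + Λ g
    Λ-0 : ∀ {C A B} → Λ (0h {C × A} {B}) ≈ 0h
    D-Λ : ∀ {C A B} (f : Hom (C × A) B) →
          D (Λ f) ≈ Λ (D f ∘ ⟨ ⟨ π₁ ∘ π₁ , 0h {A} {A} ∘ π₂ ⟩ , ⟨ π₂ ∘ π₁ , id ∘ π₂ ⟩ ⟩)

module CCDCNotation {o ℓ e} (𝒞 : CCDC o ℓ e) where
  open CCDC 𝒞

  _⊗_ : ∀ {A B A' B'} → Hom A A' → Hom B B' → Hom (A × B) (A' × B')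
  f ⊗ g = ⟨ f ∘ π₁ , g ∘ π₂ ⟩

  Λ⁻ : ∀ {C A B} → Hom C (A ⇒ B) → Hom (C × A) B
  Λ⁻ h = ev ∘ (h ⊗ id)

  isLinear : ∀ {A B} → Hom A B → Set e
  isLinear f = D f ≈ f ∘ π₁

  _⋆_ : ∀ {C A B} → Hom (C × A) B → Hom C A → Hom (C × A) B
  _⋆_ {C} f g = D f ∘ ⟨ ⟨ 0h {_} {C} , g ∘ π₁ ⟩ , id ⟩

record LinearReflexive {o ℓ e} (𝒞 : CCDC o ℓ e) : Set (o ⊔ ℓ ⊔ e) where
  open CCDC 𝒞
  open CCDCNotation 𝒞
  field
    U : Obj
    𝒜 : Hom U (U ⇒ U)
    lam : Hom (U ⇒ U) U
    𝒜∘lam : 𝒜 ∘ lam ≈ id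
    𝒜-linear : isLinear 𝒜
    lam-linear : isLinear lam

-- Simple n / Sum n : terms whose free variables are among n variables;
-- de Bruijn index zero is the LAST variable of the context sequence.

data Simple (n : ℕ) : Set
data Sum (n : ℕ) : Set

data Simple n where
  var  : Fin n → Simple n
  ƛ    : Simple (suc n) → Simple n
  _·_  : Simple n → Sum n → Simple n
  D⟨_⟩_ : Simple n → Simple n → Simple n

data Sum n where
  0ₜ   : Sum n
  _+ₜ_ : Simple n → Sum n → Sum n

infixr 5 _+ₜ_

_++ₜ_ : ∀ {n} → Sum n → Sum n → Sum n
0ₜ ++ₜ T = T
(s +ₜ S) ++ₜ T = s +ₜ (S ++ₜ T)

ƛΣ : ∀ {n} → Sum (suc n) → Sum n
ƛΣ 0ₜ = 0ₜ
ƛΣ (s +ₜ S) = ƛ s +ₜ ƛΣ S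

appΣ : ∀ {n} → Sum n → Sum n → Sum n
appΣ 0ₜ V = 0ₜ
appΣ (s +ₜ S) V = (s · V) +ₜ appΣ S V

DΣʳ : ∀ {n} → Simple n → Sum n → Sum n
DΣʳ s 0ₜ = 0ₜ
DΣʳ s (t +ₜ T) = (D⟨ s ⟩ t) +ₜ DΣʳ s T

DΣ : ∀ {n} → Sum n → Sum n → Sum n
DΣ 0ₜ T = 0ₜ
DΣ (s +ₜ S) T = DΣʳ s T ++ₜ DΣ S T

ext : ∀ {m k} → (Fin m → Fin k) → Fin (suc m) → Fin (suc k)
ext ρ zero = zero
ext ρ (suc i) = suc (ρ i)

renˢ : ∀ {m k} → (Fin m → Fin k) → Simple m → Simple k
renΣ : ∀ {m k} → (Fin m → Fin k) → Sum m → Sum k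
renˢ ρ (var i) = var (ρ i)
renˢ ρ (ƛ s) = ƛ (renˢ (ext ρ) s)
renˢ ρ (s · T) = renˢ ρ s · renΣ ρ T
renˢ ρ (D⟨ s ⟩ t) = D⟨ renˢ ρ s ⟩ renˢ ρ t
renΣ ρ 0ₜ = 0ₜ
renΣ ρ (s +ₜ S) = renˢ ρ s +ₜ renΣ ρ S

wkΣ : ∀ {n} → Sum n → Sum (suc n)
wkΣ = renΣ suc

-- differential substitution ∂s/∂y · T, with y the variable of index i
∂ˢ : ∀ {n} → Fin n → Simple n → Sum n → Sum n
∂Σ : ∀ {n} → Fin n → Sum n → Sum n → Sum n
∂ˢ i (var j) T with j ≟ i
... | yes _ = T
... | no _ = 0ₜ
∂ˢ i (ƛ s) T = ƛΣ (∂ˢ (suc i) s (wkΣ T))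
∂ˢ i (s · V) T = appΣ (∂ˢ i s T) V ++ₜ appΣ (DΣʳ s (∂Σ i V T)) V
∂ˢ i (D⟨ s ⟩ u) T = DΣ (∂ˢ i s T) (u +ₜ 0ₜ) ++ₜ DΣʳ s (∂ˢ i u T)
∂Σ i 0ₜ T = 0ₜ
∂Σ i (s +ₜ S) T = ∂ˢ i s T ++ₜ ∂Σ i S T

module Interpretation {o ℓ e} (𝒞 : CCDC o ℓ e) (𝒰 : LinearReflexive 𝒞) where
  open CCDC 𝒞
  open CCDCNotation 𝒞
  open LinearReflexive 𝒰

  U^ : ℕ → Obj
  U^ zero = ⊤
  U^ (suc n) = U^ n × U

  proj : ∀ {n} → Fin n → Hom (U^ n) U
  proj zero = π₂
  proj (suc i) = proj i ∘ π₁

  ⟦_⟧ˢ : ∀ {n} → Simple n → Hom (U^ n) U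
  ⟦_⟧Σ : ∀ {n} → Sum n → Hom (U^ n) U
  ⟦ var i ⟧ˢ = proj i
  ⟦ ƛ s ⟧ˢ = lam ∘ Λ ⟦ s ⟧ˢ
  ⟦ s · T ⟧ˢ = ev ∘ ⟨ 𝒜 ∘ ⟦ s ⟧ˢ , ⟦ T ⟧Σ ⟩
  ⟦ D⟨ s ⟩ t ⟧ˢ = lam ∘ Λ (Λ⁻ (𝒜 ∘ ⟦ s ⟧ˢ) ⋆ ⟦ t ⟧ˢ)
  ⟦ 0ₜ ⟧Σ = 0h
  ⟦ s +ₜ S ⟧Σ = ⟦ s ⟧ˢ + ⟦ S ⟧Σ

-- ∂S/∂y · T is interpreted as the derivative of ⟦ S ⟧ along the vector field τ whose y-component is ⟦ T ⟧
-- and whose other components vanish; when y is the last variable this derivative is ⟦ S ⟧ ⋆ ⟦ T ⟧. For an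
-- arbitrary variable the claim goes by induction on S: variables are linear projections; λ-abstraction
-- commutes with the derivative by the axiom for D ∘ Λ, with τ extended by 0 on the bound variable;
-- application splits by the chain rule into its two summands because ev is linear in the function; and
-- differential application satisfies a product rule obtained from D6 and the symmetry D7.

module Submission where

open import Data.Nat using (ℕ; zero; suc)
open import Data.Fin using (Fin; zero; suc; _≟_)
open import Relation.Binary.Bundles using (Setoid)
open import Relation.Binary.PropositionalEquality as ≡ using (_≢_)
open import Relation.Nullary using (yes; no)
open import Algebra.Structures using (IsCommutativeMonoid)
import Relation.Binary.Reasoning.Setoid as SetoidReasoning

open import Defs

module Properties {o ℓ e} (𝒞 : CCDC o ℓ e) where
  open CCDC 𝒞
  open CCDCNotation 𝒞

  hom-setoid : Obj → Obj → Setoid ℓ e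
  hom-setoid A B = record { isEquivalence = ≈-isEquivalence {A} {B} }

  open module HomSetoid {A B} = Setoid (hom-setoid A B) public using (refl; sym; trans)
  open module HomReasoning {A B} = SetoidReasoning (hom-setoid A B) public
  open module HomMonoid {A B} = IsCommutativeMonoid (+-isCommutativeMonoid {A} {B}) public
    using () renaming (∙-cong to +-cong; assoc to +-assoc; comm to +-comm; identityˡ to +-identityˡ; identityʳ to +-identityʳ)

  ∘-resp-≈ˡ : ∀ {A B C} {f f' : Hom B C} {g : Hom A B} → f ≈ f' → f ∘ g ≈ f' ∘ g
  ∘-resp-≈ˡ p = ∘-resp-≈ p refl

  ∘-resp-≈ʳ : ∀ {A B C} {f : Hom B C} {g g' : Hom A B} → g ≈ g' → f ∘ g ≈ f ∘ g'
  ∘-resp-≈ʳ p = ∘-resp-≈ refl p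

  sym-assoc : ∀ {A B C D} {f : Hom C D} {g : Hom B C} {h : Hom A B} → f ∘ (g ∘ h) ≈ (f ∘ g) ∘ h
  sym-assoc = sym (assoc _ _ _)

  pullˡ : ∀ {A B C D} {f : Hom C D} {g : Hom B C} {h : Hom A B} {fg : Hom B D} →
          f ∘ g ≈ fg → f ∘ (g ∘ h) ≈ fg ∘ h
  pullˡ p = trans sym-assoc (∘-resp-≈ˡ p)

  pullʳ : ∀ {A B C D} {f : Hom C D} {g : Hom B C} {h : Hom A B} {gh : Hom A C} →
          g ∘ h ≈ gh → (f ∘ g) ∘ h ≈ f ∘ gh
  pullʳ p = trans (assoc _ _ _) (∘-resp-≈ʳ p)

  project₁ : ∀ {C A B} {f : Hom C A} {g : Hom C B} → π₁ ∘ ⟨ f , g ⟩ ≈ f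
  project₁ = π₁-⟨⟩ _ _

  project₂ : ∀ {C A B} {f : Hom C A} {g : Hom C B} → π₂ ∘ ⟨ f , g ⟩ ≈ g
  project₂ = π₂-⟨⟩ _ _

  ⟨⟩-cong₂ : ∀ {C A B} {f f' : Hom C A} {g g' : Hom C B} → f ≈ f' → g ≈ g' → ⟨ f , g ⟩ ≈ ⟨ f' , g' ⟩
  ⟨⟩-cong₂ p q = ⟨⟩-unique _ (trans project₁ p) (trans project₂ q)

  ⟨⟩∘ : ∀ {X C A B} {f : Hom C A} {g : Hom C B} {h : Hom X C} → ⟨ f , g ⟩ ∘ h ≈ ⟨ f ∘ h , g ∘ h ⟩
  ⟨⟩∘ = ⟨⟩-unique _ (pullˡ project₁) (pullˡ project₂)

  η : ∀ {A B} → ⟨ π₁ , π₂ ⟩ ≈ id {A × B}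
  η = sym (⟨⟩-unique id (identityʳ _) (identityʳ _))

  ⊗∘⟨⟩ : ∀ {X A B A' B'} {f : Hom A A'} {g : Hom B B'} {a : Hom X A} {b : Hom X B} →
         (f ⊗ g) ∘ ⟨ a , b ⟩ ≈ ⟨ f ∘ a , g ∘ b ⟩
  ⊗∘⟨⟩ = trans ⟨⟩∘ (⟨⟩-cong₂ (pullʳ project₁) (pullʳ project₂))

  ⊗∘⊗ : ∀ {A B A' B' A'' B''} {f : Hom A' A''} {g : Hom B' B''} {h : Hom A A'} {k : Hom B B'} →
        (f ⊗ g) ∘ (h ⊗ k) ≈ (f ∘ h) ⊗ (g ∘ k)
  ⊗∘⊗ = trans ⊗∘⟨⟩ (⟨⟩-cong₂ sym-assoc sym-assoc)

  ⊗id∘⊗id : ∀ {A B C D} {f : Hom B C} {g : Hom A B} → (f ⊗ id {D}) ∘ (g ⊗ id) ≈ (f ∘ g) ⊗ id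
  ⊗id∘⊗id = trans ⊗∘⊗ (⟨⟩-cong₂ refl (∘-resp-≈ˡ (identityˡ id)))

  id⊗id : ∀ {A B} → id {A} ⊗ id {B} ≈ id
  id⊗id = trans (⟨⟩-cong₂ (identityˡ _) (identityˡ _)) η

  ⟨⟩+⟨⟩ : ∀ {C A B} {a c : Hom C A} {b d : Hom C B} → ⟨ a , b ⟩ + ⟨ c , d ⟩ ≈ ⟨ a + c , b + d ⟩
  ⟨⟩+⟨⟩ = ⟨⟩-unique _ (trans (π₁-+ _ _) (+-cong project₁ project₁))
                       (trans (π₂-+ _ _) (+-cong project₂ project₂))

  ⟨⟩-0 : ∀ {C A B} → ⟨ 0h {C} {A} , 0h {C} {B} ⟩ ≈ 0h
  ⟨⟩-0 = sym (⟨⟩-unique 0h π₁-0 π₂-0)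

  ⟨⟩-split : ∀ {C A B} {a : Hom C A} {b : Hom C B} → ⟨ a , b ⟩ ≈ ⟨ a , 0h ⟩ + ⟨ 0h , b ⟩
  ⟨⟩-split = sym (trans ⟨⟩+⟨⟩ (⟨⟩-cong₂ (+-identityʳ _) (+-identityˡ _)))

  Λ-cong : ∀ {C A B} {f g : Hom (C × A) B} → f ≈ g → Λ f ≈ Λ g
  Λ-cong p = Λ-unique _ (trans (Λ-β _) p)

  Λ-∘ : ∀ {X C A B} {f : Hom (C × A) B} {h : Hom X C} → Λ f ∘ h ≈ Λ (f ∘ (h ⊗ id))
  Λ-∘ {f = f} {h} = Λ-unique _ (begin
    ev ∘ ((Λ f ∘ h) ⊗ id)        ≈⟨ ∘-resp-≈ʳ ⊗id∘⊗id ⟨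
    ev ∘ ((Λ f ⊗ id) ∘ (h ⊗ id)) ≈⟨ pullˡ (Λ-β f) ⟩
    f ∘ (h ⊗ id)                 ∎)

  Λ-ev : ∀ {A B} → Λ (ev {A} {B}) ≈ id
  Λ-ev = sym (Λ-unique id (trans (∘-resp-≈ʳ id⊗id) (identityʳ ev)))

  β : ∀ {X C A B} {f : Hom (C × A) B} {h : Hom X C} {c : Hom X A} → ev ∘ ⟨ Λ f ∘ h , c ⟩ ≈ f ∘ ⟨ h , c ⟩
  β {f = f} {h} {c} = begin
    ev ∘ ⟨ Λ f ∘ h , c ⟩          ≈⟨ ∘-resp-≈ʳ (trans ⊗∘⟨⟩ (⟨⟩-cong₂ refl (identityˡ c))) ⟨
    ev ∘ ((Λ f ⊗ id) ∘ ⟨ h , c ⟩) ≈⟨ pullˡ (Λ-β f) ⟩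
    f ∘ ⟨ h , c ⟩                 ∎

  Λ⁻-cong : ∀ {C A B} {h h' : Hom C (A ⇒ B)} → h ≈ h' → Λ⁻ h ≈ Λ⁻ h'
  Λ⁻-cong p = ∘-resp-≈ʳ (⟨⟩-cong₂ (∘-resp-≈ˡ p) refl)

  Λ⁻-∘ : ∀ {X C A B} {h : Hom C (A ⇒ B)} {r : Hom X C} → Λ⁻ (h ∘ r) ≈ Λ⁻ h ∘ (r ⊗ id)
  Λ⁻-∘ = trans (∘-resp-≈ʳ (sym ⊗id∘⊗id)) sym-assoc

  D-∘ : ∀ {X A B C} {f : Hom B C} {g : Hom A B} {h : Hom X (A × A)} →
        D (f ∘ g) ∘ h ≈ D f ∘ ⟨ D g ∘ h , g ∘ (π₂ ∘ h) ⟩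
  D-∘ = trans (∘-resp-≈ˡ (D5 _ _)) (pullʳ (trans ⟨⟩∘ (⟨⟩-cong₂ refl (assoc _ _ _))))

  D-⟨⟩∘ : ∀ {X C A B} {f : Hom C A} {g : Hom C B} {h : Hom X (C × C)} →
          D ⟨ f , g ⟩ ∘ h ≈ ⟨ D f ∘ h , D g ∘ h ⟩
  D-⟨⟩∘ = trans (∘-resp-≈ˡ (D4 _ _)) ⟨⟩∘

  D-id∘ : ∀ {X A} {a b : Hom X A} → D id ∘ ⟨ a , b ⟩ ≈ a
  D-id∘ = trans (∘-resp-≈ˡ D3-id) project₁

  D-0∘ : ∀ {X A B} {h : Hom X (A × A)} → D (0h {A} {B}) ∘ h ≈ 0h
  D-0∘ = trans (∘-resp-≈ˡ D1-0) (0-∘ _)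

  D-⊗∘ : ∀ {X A B A' B'} {f : Hom A A'} {g : Hom B B'} {a : Hom X A} {b : Hom X B} {x : Hom X (A × B)} →
         D (f ⊗ g) ∘ ⟨ ⟨ a , b ⟩ , x ⟩ ≈ ⟨ D f ∘ ⟨ a , π₁ ∘ x ⟩ , D g ∘ ⟨ b , π₂ ∘ x ⟩ ⟩
  D-⊗∘ {X} {A} {B} {a = a} {b} {x} = trans D-⟨⟩∘ (⟨⟩-cong₂ (D-∘π D3-π₁ project₁) (D-∘π D3-π₂ project₂))
    where
    D-∘π : ∀ {P R} {p : Hom (A × B) P} {f : Hom P R} {c : Hom X P} →
           D p ≈ p ∘ π₁ → p ∘ ⟨ a , b ⟩ ≈ c →
           D (f ∘ p) ∘ ⟨ ⟨ a , b ⟩ , x ⟩ ≈ D f ∘ ⟨ c , p ∘ x ⟩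
    D-∘π linear eq = trans D-∘ (∘-resp-≈ʳ (⟨⟩-cong₂
      (trans (∘-resp-≈ˡ linear) (trans (pullʳ project₁) eq))
      (∘-resp-≈ʳ project₂)))

  D-⊗id∘vertical : ∀ {X A B A'} {f : Hom A A'} {b : Hom X B} {x : Hom X (A × B)} →
                   D (f ⊗ id) ∘ ⟨ ⟨ 0h , b ⟩ , x ⟩ ≈ ⟨ 0h , b ⟩
  D-⊗id∘vertical = trans D-⊗∘ (⟨⟩-cong₂ (D2-0 _ _) D-id∘)

  -- The derivative of f along the vector field τ; f ⋆ g is the derivative along ⟨ 0h , g ∘ π₁ ⟩.
  D[_∣_] : ∀ {A B} → Hom A B → Hom A A → Hom A B
  D[ f ∣ τ ] = D f ∘ ⟨ τ , id ⟩

  D[]-cong : ∀ {A B} {f f' : Hom A B} {τ τ' : Hom A A} → f ≈ f' → τ ≈ τ' → D[ f ∣ τ ] ≈ D[ f' ∣ τ' ]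
  D[]-cong p q = ∘-resp-≈ (D-resp-≈ p) (⟨⟩-cong₂ q refl)

  D[]-+ : ∀ {A B} {f g : Hom A B} {τ : Hom A A} → D[ f + g ∣ τ ] ≈ D[ f ∣ τ ] + D[ g ∣ τ ]
  D[]-+ = trans (∘-resp-≈ˡ (D1-+ _ _)) (+-∘ _ _ _)

  D[]-0 : ∀ {A B} {τ : Hom A A} → D[ 0h {A} {B} ∣ τ ] ≈ 0h
  D[]-0 = D-0∘

  D[]∘ : ∀ {X A B} {f : Hom A B} {τ : Hom A A} {r : Hom X A} → D[ f ∣ τ ] ∘ r ≈ D f ∘ ⟨ τ ∘ r , r ⟩
  D[]∘ = trans (pullʳ ⟨⟩∘) (∘-resp-≈ʳ (⟨⟩-cong₂ refl (identityˡ _)))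

  D[∘] : ∀ {A B C} {f : Hom B C} {g : Hom A B} {τ : Hom A A} → D[ f ∘ g ∣ τ ] ≈ D f ∘ ⟨ D[ g ∣ τ ] , g ⟩
  D[∘] = trans D-∘ (∘-resp-≈ʳ (⟨⟩-cong₂ refl (trans (∘-resp-≈ʳ project₂) (identityʳ _))))

  D[∘π₁] : ∀ {C A B} {f : Hom C B} {τ : Hom C C} {g : Hom A A} → D[ f ∘ π₁ ∣ τ ⊗ g ] ≈ D[ f ∣ τ ] ∘ π₁
  D[∘π₁] = trans D-∘ (trans (∘-resp-≈ʳ (⟨⟩-cong₂
    (trans (∘-resp-≈ˡ D3-π₁) (trans (pullʳ project₁) project₁))
    (trans (∘-resp-≈ʳ project₂) (identityʳ π₁)))) (sym D[]∘))

  linear-D∘ : ∀ {X A B} {f : Hom A B} {a b : Hom X A} → isLinear f → D f ∘ ⟨ a , b ⟩ ≈ f ∘ a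
  linear-D∘ linear = trans (∘-resp-≈ˡ linear) (pullʳ project₁)

  linear-+ : ∀ {X A B} {f : Hom A B} {a b : Hom X A} → isLinear f → f ∘ (a + b) ≈ f ∘ a + f ∘ b
  linear-+ {f = f} {a} {b} linear = begin
    f ∘ (a + b)                       ≈⟨ linear-D∘ linear ⟨
    D f ∘ ⟨ a + b , a ⟩               ≈⟨ D2-+ _ _ _ _ ⟩
    D f ∘ ⟨ a , a ⟩ + D f ∘ ⟨ b , a ⟩ ≈⟨ +-cong (linear-D∘ linear) (linear-D∘ linear) ⟩
    f ∘ a + f ∘ b                     ∎

  linear-0 : ∀ {X A B} {f : Hom A B} → isLinear f → f ∘ 0h {X} ≈ 0h
  linear-0 linear = trans (sym (linear-D∘ {b = 0h} linear)) (D2-0 _ _)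

  ∘-linear : ∀ {A B C} {f : Hom B C} {g : Hom A B} → isLinear f → isLinear g → isLinear (f ∘ g)
  ∘-linear linear-f linear-g =
    trans (D5 _ _) (trans (linear-D∘ linear-f) (trans (∘-resp-≈ʳ linear-g) sym-assoc))

  D[linear∘] : ∀ {A B C} {f : Hom B C} {g : Hom A B} {τ : Hom A A} →
               isLinear f → D[ f ∘ g ∣ τ ] ≈ f ∘ D[ g ∣ τ ]
  D[linear∘] linear = trans D[∘] (linear-D∘ linear)

  Λ-tangent : ∀ {C A} → Hom ((C × C) × A) ((C × A) × (C × A))
  Λ-tangent = ⟨ π₁ ⊗ 0h , π₂ ⊗ id ⟩

  -- Since Λ ev = id and D id = π₁, the axiom for D ∘ Λ says that ev is linear in its function argument.
  ev-linearˡ : ∀ {X A B} {a b : Hom X (A ⇒ B)} {c : Hom X A} →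
               D ev ∘ ⟨ ⟨ a , 0h ⟩ , ⟨ b , c ⟩ ⟩ ≈ ev ∘ ⟨ a , c ⟩
  ev-linearˡ {a = a} {b} {c} = begin
    D ev ∘ ⟨ ⟨ a , 0h ⟩ , ⟨ b , c ⟩ ⟩        ≈⟨ pullʳ Λ-tangent∘ ⟨
    (D ev ∘ Λ-tangent) ∘ ⟨ ⟨ a , b ⟩ , c ⟩ ≈⟨ ∘-resp-≈ˡ (trans (Λ⁻-cong π₁≈Λ[Dev∘Λ-tangent]) (Λ-β _)) ⟨
    Λ⁻ π₁ ∘ ⟨ ⟨ a , b ⟩ , c ⟩              ≈⟨ pullʳ (trans ⊗∘⟨⟩ (⟨⟩-cong₂ project₁ (identityˡ c))) ⟩
    ev ∘ ⟨ a , c ⟩                         ∎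
    where
    Λ-tangent∘ : Λ-tangent ∘ ⟨ ⟨ a , b ⟩ , c ⟩ ≈ ⟨ ⟨ a , 0h ⟩ , ⟨ b , c ⟩ ⟩
    Λ-tangent∘ = trans ⟨⟩∘ (⟨⟩-cong₂ (trans ⊗∘⟨⟩ (⟨⟩-cong₂ project₁ (0-∘ c)))
                                     (trans ⊗∘⟨⟩ (⟨⟩-cong₂ project₂ (identityˡ c))))
    π₁≈Λ[Dev∘Λ-tangent] : π₁ ≈ Λ (D ev ∘ Λ-tangent)
    π₁≈Λ[Dev∘Λ-tangent] = trans (sym D3-id) (trans (D-resp-≈ (sym Λ-ev)) (D-Λ ev))

  ev-+ˡ : ∀ {X A B} {a b : Hom X (A ⇒ B)} {c : Hom X A} →
          ev ∘ ⟨ a + b , c ⟩ ≈ ev ∘ ⟨ a , c ⟩ + ev ∘ ⟨ b , c ⟩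
  ev-+ˡ {a = a} {b} {c} = begin
    ev ∘ ⟨ a + b , c ⟩                                                  ≈⟨ ev-linearˡ ⟨
    D ev ∘ ⟨ ⟨ a + b , 0h ⟩ , ⟨ a , c ⟩ ⟩                               ≈⟨ ∘-resp-≈ʳ (⟨⟩-cong₂ split refl) ⟩
    D ev ∘ ⟨ ⟨ a , 0h ⟩ + ⟨ b , 0h ⟩ , ⟨ a , c ⟩ ⟩                      ≈⟨ D2-+ _ _ _ _ ⟩
    D ev ∘ ⟨ ⟨ a , 0h ⟩ , ⟨ a , c ⟩ ⟩ + D ev ∘ ⟨ ⟨ b , 0h ⟩ , ⟨ a , c ⟩ ⟩ ≈⟨ +-cong ev-linearˡ ev-linearˡ ⟩
    ev ∘ ⟨ a , c ⟩ + ev ∘ ⟨ b , c ⟩                                     ∎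
    where
    split : ⟨ a + b , 0h ⟩ ≈ ⟨ a , 0h ⟩ + ⟨ b , 0h ⟩
    split = sym (trans ⟨⟩+⟨⟩ (⟨⟩-cong₂ refl (+-identityʳ 0h)))

  ev-0ˡ : ∀ {X A B} {c : Hom X A} → ev {A} {B} ∘ ⟨ 0h , c ⟩ ≈ 0h
  ev-0ˡ = trans (sym (ev-linearˡ {b = 0h})) (trans (∘-resp-≈ʳ (⟨⟩-cong₂ ⟨⟩-0 refl)) (D2-0 _ _))

  D-ev-split : ∀ {X A B} {a h : Hom X (A ⇒ B)} {g c : Hom X A} →
               D ev ∘ ⟨ ⟨ a , g ⟩ , ⟨ h , c ⟩ ⟩ ≈ ev ∘ ⟨ a , c ⟩ + D ev ∘ ⟨ ⟨ 0h , g ⟩ , ⟨ h , c ⟩ ⟩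
  D-ev-split = trans (∘-resp-≈ʳ (⟨⟩-cong₂ ⟨⟩-split refl)) (trans (D2-+ _ _ _ _) (+-cong ev-linearˡ refl))

  Λ⁻-+ : ∀ {C A B} {h k : Hom C (A ⇒ B)} → Λ⁻ (h + k) ≈ Λ⁻ h + Λ⁻ k
  Λ⁻-+ = trans (∘-resp-≈ʳ (⟨⟩-cong₂ (+-∘ _ _ _) refl)) ev-+ˡ

  Λ⁻-0 : ∀ {C A B} → Λ⁻ (0h {C} {A ⇒ B}) ≈ 0h
  Λ⁻-0 = trans (∘-resp-≈ʳ (⟨⟩-cong₂ (0-∘ _) refl)) ev-0ˡ

  ⋆-cong : ∀ {C A B} {f f' : Hom (C × A) B} {g g' : Hom C A} → f ≈ f' → g ≈ g' → f ⋆ g ≈ f' ⋆ g'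
  ⋆-cong p q = D[]-cong p (⟨⟩-cong₂ refl (∘-resp-≈ˡ q))

  ⋆-+ʳ : ∀ {C A B} {f : Hom (C × A) B} {g h : Hom C A} → f ⋆ (g + h) ≈ f ⋆ g + f ⋆ h
  ⋆-+ʳ {g = g} {h} = trans (∘-resp-≈ʳ (⟨⟩-cong₂ split refl)) (D2-+ _ _ _ _)
    where
    split : ⟨ 0h , (g + h) ∘ π₁ ⟩ ≈ ⟨ 0h , g ∘ π₁ ⟩ + ⟨ 0h , h ∘ π₁ ⟩
    split = sym (trans ⟨⟩+⟨⟩ (⟨⟩-cong₂ (+-identityˡ 0h) (sym (+-∘ _ _ _))))

  ⋆-0ʳ : ∀ {C A B} {f : Hom (C × A) B} → f ⋆ 0h {C} {A} ≈ 0h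
  ⋆-0ʳ = trans (∘-resp-≈ʳ (⟨⟩-cong₂ (trans (⟨⟩-cong₂ refl (0-∘ _)) ⟨⟩-0) refl)) (D2-0 _ _)

  ⋆-∘⊗ : ∀ {X C A B} {f : Hom (C × A) B} {g : Hom C A} {r : Hom X C} →
         (f ⋆ g) ∘ (r ⊗ id) ≈ (f ∘ (r ⊗ id)) ⋆ (g ∘ r)
  ⋆-∘⊗ {f = f} {g} {r} = begin
    (f ⋆ g) ∘ (r ⊗ id)                                      ≈⟨ D[]∘ ⟩
    D f ∘ ⟨ ⟨ 0h , g ∘ π₁ ⟩ ∘ (r ⊗ id) , r ⊗ id ⟩           ≈⟨ ∘-resp-≈ʳ (⟨⟩-cong₂ vertical∘ refl) ⟩
    D f ∘ ⟨ ⟨ 0h , (g ∘ r) ∘ π₁ ⟩ , r ⊗ id ⟩                ≈⟨ ∘-resp-≈ʳ (⟨⟩-cong₂ D-⊗id∘vertical refl) ⟨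
    D f ∘ ⟨ D[ r ⊗ id ∣ ⟨ 0h , (g ∘ r) ∘ π₁ ⟩ ] , r ⊗ id ⟩ ≈⟨ D[∘] ⟨
    (f ∘ (r ⊗ id)) ⋆ (g ∘ r)                                ∎
    where
    vertical∘ : ⟨ 0h , g ∘ π₁ ⟩ ∘ (r ⊗ id) ≈ ⟨ 0h , (g ∘ r) ∘ π₁ ⟩
    vertical∘ = trans ⟨⟩∘ (⟨⟩-cong₂ (0-∘ _) (trans (pullʳ project₁) sym-assoc))

  Λ⁻⋆∘⟨id,-⟩ : ∀ {C A B} {h : Hom C (A ⇒ B)} {g c : Hom C A} →
               (Λ⁻ h ⋆ g) ∘ ⟨ id , c ⟩ ≈ D ev ∘ ⟨ ⟨ 0h , g ⟩ , ⟨ h , c ⟩ ⟩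
  Λ⁻⋆∘⟨id,-⟩ {h = h} {g} {c} = begin
    (Λ⁻ h ⋆ g) ∘ ⟨ id , c ⟩
      ≈⟨ D[]∘ ⟩
    D (Λ⁻ h) ∘ ⟨ ⟨ 0h , g ∘ π₁ ⟩ ∘ ⟨ id , c ⟩ , ⟨ id , c ⟩ ⟩
      ≈⟨ ∘-resp-≈ʳ (⟨⟩-cong₂ vertical∘ refl) ⟩
    D (ev ∘ (h ⊗ id)) ∘ ⟨ ⟨ 0h , g ⟩ , ⟨ id , c ⟩ ⟩
      ≈⟨ trans D-∘ (∘-resp-≈ʳ (⟨⟩-cong₂ D-⊗id∘vertical refl)) ⟩
    D ev ∘ ⟨ ⟨ 0h , g ⟩ , (h ⊗ id) ∘ (π₂ ∘ ⟨ ⟨ 0h , g ⟩ , ⟨ id , c ⟩ ⟩) ⟩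
      ≈⟨ ∘-resp-≈ʳ (⟨⟩-cong₂ refl (trans (∘-resp-≈ʳ project₂) (trans ⊗∘⟨⟩ (⟨⟩-cong₂ (identityʳ h) (identityˡ c))))) ⟩
    D ev ∘ ⟨ ⟨ 0h , g ⟩ , ⟨ h , c ⟩ ⟩ ∎
    where
    vertical∘ : ⟨ 0h , g ∘ π₁ ⟩ ∘ ⟨ id , c ⟩ ≈ ⟨ 0h , g ⟩
    vertical∘ = trans ⟨⟩∘ (⟨⟩-cong₂ (0-∘ _) (trans (pullʳ project₁) (identityʳ g)))

  D[Λ] : ∀ {C A B} {f : Hom (C × A) B} {τ : Hom C C} → D[ Λ f ∣ τ ] ≈ Λ D[ f ∣ τ ⊗ 0h ]
  D[Λ] {f = f} {τ} = begin
    D (Λ f) ∘ ⟨ τ , id ⟩                      ≈⟨ ∘-resp-≈ˡ (D-Λ f) ⟩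
    Λ (D f ∘ Λ-tangent) ∘ ⟨ τ , id ⟩          ≈⟨ Λ-∘ ⟩
    Λ ((D f ∘ Λ-tangent) ∘ (⟨ τ , id ⟩ ⊗ id)) ≈⟨ Λ-cong (pullʳ Λ-tangent∘) ⟩
    Λ (D f ∘ ⟨ τ ⊗ 0h , id ⟩)                 ∎
    where
    Λ-tangent∘ : Λ-tangent ∘ (⟨ τ , id ⟩ ⊗ id) ≈ ⟨ τ ⊗ 0h , id ⟩
    Λ-tangent∘ = trans ⟨⟩∘ (⟨⟩-cong₂
      (trans ⊗∘⊗ (⟨⟩-cong₂ (∘-resp-≈ˡ project₁) (∘-resp-≈ˡ (0-∘ id))))
      (trans ⊗∘⊗ (trans (⟨⟩-cong₂ (∘-resp-≈ˡ project₂) (∘-resp-≈ˡ (identityˡ id))) id⊗id)))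

  D[Λ⁻] : ∀ {C A B} {h : Hom C (A ⇒ B)} {τ : Hom C C} → D[ Λ⁻ h ∣ τ ⊗ 0h ] ≈ Λ⁻ D[ h ∣ τ ]
  D[Λ⁻] {h = h} {τ} = begin
    D[ ev ∘ (h ⊗ id) ∣ τ ⊗ 0h ]                                ≈⟨ D[∘] ⟩
    D ev ∘ ⟨ D[ h ⊗ id ∣ τ ⊗ 0h ] , h ⊗ id ⟩                   ≈⟨ ∘-resp-≈ʳ (⟨⟩-cong₂ D[h⊗id] refl) ⟩
    D ev ∘ ⟨ ⟨ D[ h ∣ τ ] ∘ π₁ , 0h ⟩ , ⟨ h ∘ π₁ , id ∘ π₂ ⟩ ⟩ ≈⟨ ev-linearˡ ⟩
    Λ⁻ D[ h ∣ τ ]                                               ∎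
    where
    D[h⊗id] : D[ h ⊗ id ∣ τ ⊗ 0h ] ≈ ⟨ D[ h ∣ τ ] ∘ π₁ , 0h ⟩
    D[h⊗id] = trans D-⊗∘ (⟨⟩-cong₂
      (trans (∘-resp-≈ʳ (⟨⟩-cong₂ refl (identityʳ π₁))) (sym D[]∘))
      (trans D-id∘ (0-∘ π₂)))

  -- D6 yields the summand differentiating u, the symmetry D7 of second derivatives the one differentiating H.
  D[⋆] : ∀ {C A B} {H : Hom (C × A) B} {u : Hom C A} {τ : Hom C C} →
         D[ H ⋆ u ∣ τ ⊗ 0h ] ≈ D[ H ∣ τ ⊗ 0h ] ⋆ u + H ⋆ D[ u ∣ τ ]
  D[⋆] {C} {A} {H = H} {u} {τ} = begin
    D[ D H ∘ K ∣ σ ]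
      ≈⟨ D[∘] ⟩
    D (D H) ∘ ⟨ D[ K ∣ σ ] , K ⟩
      ≈⟨ ∘-resp-≈ʳ (⟨⟩-cong₂ D[K] refl) ⟩
    D (D H) ∘ ⟨ ⟨ ⟨ 0h , v ∘ π₁ ⟩ , σ ⟩ , K ⟩
      ≈⟨ ∘-resp-≈ʳ (⟨⟩-cong₂ ⟨⟩-split refl) ⟩
    D (D H) ∘ ⟨ ⟨ ⟨ 0h , v ∘ π₁ ⟩ , 0h ⟩ + ⟨ 0h , σ ⟩ , K ⟩
      ≈⟨ D2-+ _ _ _ _ ⟩
    D (D H) ∘ ⟨ ⟨ ⟨ 0h , v ∘ π₁ ⟩ , 0h ⟩ , K ⟩ + D (D H) ∘ ⟨ ⟨ 0h , σ ⟩ , K ⟩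
      ≈⟨ +-comm _ _ ⟩
    D (D H) ∘ ⟨ ⟨ 0h , σ ⟩ , K ⟩ + D (D H) ∘ ⟨ ⟨ ⟨ 0h , v ∘ π₁ ⟩ , 0h ⟩ , K ⟩
      ≈⟨ +-cong (D7 H _ _ _) (D6 H _ _ _) ⟩
    D (D H) ∘ ⟨ ⟨ 0h , ⟨ 0h , u ∘ π₁ ⟩ ⟩ , ⟨ σ , id ⟩ ⟩ + H ⋆ v
      ≈⟨ +-cong D[H]⋆u refl ⟨
    D[ H ∣ σ ] ⋆ u + H ⋆ v ∎
    where
    σ : Hom (C × A) (C × A)
    σ = τ ⊗ 0h
    K : Hom (C × A) ((C × A) × (C × A))
    K = ⟨ ⟨ 0h , u ∘ π₁ ⟩ , id ⟩
    v : Hom C A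
    v = D[ u ∣ τ ]
    D[K] : D[ K ∣ σ ] ≈ ⟨ ⟨ 0h , v ∘ π₁ ⟩ , σ ⟩
    D[K] = trans D-⟨⟩∘ (⟨⟩-cong₂ (trans D-⟨⟩∘ (⟨⟩-cong₂ D-0∘ D[∘π₁])) D-id∘)
    D[H]⋆u : D[ H ∣ σ ] ⋆ u ≈ D (D H) ∘ ⟨ ⟨ 0h , ⟨ 0h , u ∘ π₁ ⟩ ⟩ , ⟨ σ , id ⟩ ⟩
    D[H]⋆u = trans D-∘ (∘-resp-≈ʳ (⟨⟩-cong₂
      (trans D-⟨⟩∘ (⟨⟩-cong₂ (trans D-⊗∘ (trans (⟨⟩-cong₂ (D2-0 _ _) D-0∘) ⟨⟩-0)) D-id∘))
      (trans (∘-resp-≈ʳ project₂) (identityʳ _))))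

module Semantics {o ℓ e} (𝒞 : CCDC o ℓ e) (𝒰 : LinearReflexive 𝒞) where
  open CCDC 𝒞
  open CCDCNotation 𝒞
  open LinearReflexive 𝒰
  open Interpretation 𝒞 𝒰
  open Properties 𝒞

  abs : ∀ {C} → Hom (C × U) U → Hom C U
  abs f = lam ∘ Λ f

  app : ∀ {C} → Hom C U → Hom C U → Hom C U
  app s v = ev ∘ ⟨ 𝒜 ∘ s , v ⟩

  dapp : ∀ {C} → Hom C U → Hom C U → Hom C U
  dapp s t = abs (Λ⁻ (𝒜 ∘ s) ⋆ t)

  abs-cong : ∀ {C} {f f' : Hom (C × U) U} → f ≈ f' → abs f ≈ abs f'
  abs-cong p = ∘-resp-≈ʳ (Λ-cong p)

  app-cong : ∀ {C} {s s' v v' : Hom C U} → s ≈ s' → v ≈ v' → app s v ≈ app s' v'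
  app-cong p q = ∘-resp-≈ʳ (⟨⟩-cong₂ (∘-resp-≈ʳ p) q)

  dapp-cong : ∀ {C} {s s' t t' : Hom C U} → s ≈ s' → t ≈ t' → dapp s t ≈ dapp s' t'
  dapp-cong p q = abs-cong (⋆-cong (Λ⁻-cong (∘-resp-≈ʳ p)) q)

  abs-+ : ∀ {C} {f g : Hom (C × U) U} → abs (f + g) ≈ abs f + abs g
  abs-+ = trans (∘-resp-≈ʳ (Λ-+ _ _)) (linear-+ lam-linear)

  abs-0 : ∀ {C} → abs (0h {C × U}) ≈ 0h
  abs-0 = trans (∘-resp-≈ʳ Λ-0) (linear-0 lam-linear)

  app-+ˡ : ∀ {C} {s s' v : Hom C U} → app (s + s') v ≈ app s v + app s' v
  app-+ˡ = trans (∘-resp-≈ʳ (⟨⟩-cong₂ (linear-+ 𝒜-linear) refl)) ev-+ˡ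

  app-0ˡ : ∀ {C} {v : Hom C U} → app 0h v ≈ 0h
  app-0ˡ = trans (∘-resp-≈ʳ (⟨⟩-cong₂ (linear-0 𝒜-linear) refl)) ev-0ˡ

  dapp-+ˡ : ∀ {C} {s s' t : Hom C U} → dapp (s + s') t ≈ dapp s t + dapp s' t
  dapp-+ˡ = trans (abs-cong (trans (⋆-cong (trans (Λ⁻-cong (linear-+ 𝒜-linear)) Λ⁻-+) refl) D[]-+)) abs-+

  dapp-0ˡ : ∀ {C} {t : Hom C U} → dapp 0h t ≈ 0h
  dapp-0ˡ = trans (abs-cong (trans (⋆-cong (trans (Λ⁻-cong (linear-0 𝒜-linear)) Λ⁻-0) refl) D[]-0)) abs-0

  dapp-+ʳ : ∀ {C} {s t t' : Hom C U} → dapp s (t + t') ≈ dapp s t + dapp s t'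
  dapp-+ʳ = trans (abs-cong ⋆-+ʳ) abs-+

  dapp-0ʳ : ∀ {C} {s : Hom C U} → dapp s 0h ≈ 0h
  dapp-0ʳ = trans (abs-cong ⋆-0ʳ) abs-0

  abs-∘ : ∀ {X C} {f : Hom (C × U) U} {r : Hom X C} → abs f ∘ r ≈ abs (f ∘ (r ⊗ id))
  abs-∘ = trans (assoc _ _ _) (∘-resp-≈ʳ Λ-∘)

  app-∘ : ∀ {X C} {s v : Hom C U} {r : Hom X C} → app s v ∘ r ≈ app (s ∘ r) (v ∘ r)
  app-∘ = trans (pullʳ ⟨⟩∘) (∘-resp-≈ʳ (⟨⟩-cong₂ (assoc _ _ _) refl))

  dapp-∘ : ∀ {X C} {s t : Hom C U} {r : Hom X C} → dapp s t ∘ r ≈ dapp (s ∘ r) (t ∘ r)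
  dapp-∘ = trans abs-∘ (abs-cong (trans ⋆-∘⊗ (⋆-cong (trans (sym Λ⁻-∘) (Λ⁻-cong (assoc _ _ _))) refl)))

  app-abs : ∀ {C} {f : Hom (C × U) U} {v : Hom C U} → app (abs f) v ≈ f ∘ ⟨ id , v ⟩
  app-abs {f = f} = trans (∘-resp-≈ʳ (⟨⟩-cong₂ 𝒜∘abs refl)) β
    where
    𝒜∘abs : 𝒜 ∘ abs f ≈ Λ f ∘ id
    𝒜∘abs = trans (pullˡ 𝒜∘lam) (trans (identityˡ _) (sym (identityʳ _)))

  D[abs] : ∀ {C} {f : Hom (C × U) U} {τ : Hom C C} → D[ abs f ∣ τ ] ≈ abs D[ f ∣ τ ⊗ 0h ]
  D[abs] = trans (D[linear∘] lam-linear) (∘-resp-≈ʳ D[Λ])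

  D[app] : ∀ {C} {s v : Hom C U} {τ : Hom C C} →
           D[ app s v ∣ τ ] ≈ app D[ s ∣ τ ] v + app (dapp s D[ v ∣ τ ]) v
  D[app] {s = s} {v} {τ} = begin
    D[ ev ∘ ⟨ 𝒜 ∘ s , v ⟩ ∣ τ ]
      ≈⟨ D[∘] ⟩
    D ev ∘ ⟨ D[ ⟨ 𝒜 ∘ s , v ⟩ ∣ τ ] , ⟨ 𝒜 ∘ s , v ⟩ ⟩
      ≈⟨ ∘-resp-≈ʳ (⟨⟩-cong₂ D[⟨𝒜∘s,v⟩] refl) ⟩
    D ev ∘ ⟨ ⟨ 𝒜 ∘ D[ s ∣ τ ] , D[ v ∣ τ ] ⟩ , ⟨ 𝒜 ∘ s , v ⟩ ⟩
      ≈⟨ D-ev-split ⟩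
    app D[ s ∣ τ ] v + D ev ∘ ⟨ ⟨ 0h , D[ v ∣ τ ] ⟩ , ⟨ 𝒜 ∘ s , v ⟩ ⟩
      ≈⟨ +-cong refl (trans app-abs Λ⁻⋆∘⟨id,-⟩) ⟨
    app D[ s ∣ τ ] v + app (dapp s D[ v ∣ τ ]) v ∎
    where
    D[⟨𝒜∘s,v⟩] : D[ ⟨ 𝒜 ∘ s , v ⟩ ∣ τ ] ≈ ⟨ 𝒜 ∘ D[ s ∣ τ ] , D[ v ∣ τ ] ⟩
    D[⟨𝒜∘s,v⟩] = trans D-⟨⟩∘ (⟨⟩-cong₂ (D[linear∘] 𝒜-linear) refl)

  D[dapp] : ∀ {C} {s u : Hom C U} {τ : Hom C C} →
            D[ dapp s u ∣ τ ] ≈ dapp D[ s ∣ τ ] u + dapp s D[ u ∣ τ ]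
  D[dapp] {C} {s} {u} {τ} = begin
    D[ abs (H ⋆ u) ∣ τ ]                            ≈⟨ D[abs] ⟩
    abs D[ H ⋆ u ∣ τ ⊗ 0h ]                         ≈⟨ abs-cong D[⋆] ⟩
    abs (D[ H ∣ τ ⊗ 0h ] ⋆ u + H ⋆ D[ u ∣ τ ])      ≈⟨ abs-+ ⟩
    abs (D[ H ∣ τ ⊗ 0h ] ⋆ u) + dapp s D[ u ∣ τ ]   ≈⟨ +-cong (abs-cong (⋆-cong D[H] refl)) refl ⟩
    dapp D[ s ∣ τ ] u + dapp s D[ u ∣ τ ]           ∎
    where
    H : Hom (C × U) U
    H = Λ⁻ (𝒜 ∘ s)
    D[H] : D[ H ∣ τ ⊗ 0h ] ≈ Λ⁻ (𝒜 ∘ D[ s ∣ τ ])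
    D[H] = trans D[Λ⁻] (Λ⁻-cong (D[linear∘] 𝒜-linear))

  ⟦_⟧ʳ : ∀ {m k} → (Fin m → Fin k) → Hom (U^ k) (U^ m)
  ⟦_⟧ʳ {zero} ρ = !
  ⟦_⟧ʳ {suc m} ρ = ⟨ ⟦ (λ i → ρ (suc i)) ⟧ʳ , proj (ρ zero) ⟩

  proj∘⟦⟧ʳ : ∀ {m k} (ρ : Fin m → Fin k) (j : Fin m) → proj j ∘ ⟦ ρ ⟧ʳ ≈ proj (ρ j)
  proj∘⟦⟧ʳ ρ zero = project₂
  proj∘⟦⟧ʳ ρ (suc j) = trans (pullʳ project₁) (proj∘⟦⟧ʳ (λ i → ρ (suc i)) j)

  ⟦suc∘⟧ʳ : ∀ {m k} (ρ : Fin m → Fin k) → ⟦ (λ i → suc (ρ i)) ⟧ʳ ≈ ⟦ ρ ⟧ʳ ∘ π₁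
  ⟦suc∘⟧ʳ {zero} ρ = sym (!-unique _)
  ⟦suc∘⟧ʳ {suc m} ρ = trans (⟨⟩-cong₂ (⟦suc∘⟧ʳ (λ i → ρ (suc i))) refl) (sym ⟨⟩∘)

  ⟦id⟧ʳ : ∀ {m} → ⟦ (λ (i : Fin m) → i) ⟧ʳ ≈ id
  ⟦suc⟧ʳ : ∀ {m} → ⟦ suc {m} ⟧ʳ ≈ π₁
  ⟦id⟧ʳ {zero} = sym (!-unique _)
  ⟦id⟧ʳ {suc m} = trans (⟨⟩-cong₂ (⟦suc⟧ʳ {m}) refl) η
  ⟦suc⟧ʳ {m} = trans (⟦suc∘⟧ʳ {m} (λ i → i)) (trans (∘-resp-≈ˡ (⟦id⟧ʳ {m})) (identityˡ π₁))

  ⟦ext⟧ʳ : ∀ {m k} (ρ : Fin m → Fin k) → ⟦ ext ρ ⟧ʳ ≈ ⟦ ρ ⟧ʳ ⊗ id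
  ⟦ext⟧ʳ ρ = ⟨⟩-cong₂ (⟦suc∘⟧ʳ ρ) (sym (identityˡ π₂))

  ⟦renˢ⟧ : ∀ {m k} (ρ : Fin m → Fin k) (s : Simple m) → ⟦ renˢ ρ s ⟧ˢ ≈ ⟦ s ⟧ˢ ∘ ⟦ ρ ⟧ʳ
  ⟦renΣ⟧ : ∀ {m k} (ρ : Fin m → Fin k) (S : Sum m) → ⟦ renΣ ρ S ⟧Σ ≈ ⟦ S ⟧Σ ∘ ⟦ ρ ⟧ʳ
  ⟦renˢ⟧ ρ (var j) = sym (proj∘⟦⟧ʳ ρ j)
  ⟦renˢ⟧ ρ (ƛ s) = trans (abs-cong (trans (⟦renˢ⟧ (ext ρ) s) (∘-resp-≈ʳ (⟦ext⟧ʳ ρ)))) (sym abs-∘)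
  ⟦renˢ⟧ ρ (s · T) = trans (app-cong (⟦renˢ⟧ ρ s) (⟦renΣ⟧ ρ T)) (sym app-∘)
  ⟦renˢ⟧ ρ (D⟨ s ⟩ t) = trans (dapp-cong (⟦renˢ⟧ ρ s) (⟦renˢ⟧ ρ t)) (sym dapp-∘)
  ⟦renΣ⟧ ρ 0ₜ = sym (0-∘ _)
  ⟦renΣ⟧ ρ (s +ₜ S) = trans (+-cong (⟦renˢ⟧ ρ s) (⟦renΣ⟧ ρ S)) (sym (+-∘ _ _ _))

  ⟦wkΣ⟧ : ∀ {n} (T : Sum n) → ⟦ wkΣ T ⟧Σ ≈ ⟦ T ⟧Σ ∘ π₁
  ⟦wkΣ⟧ {n} T = trans (⟦renΣ⟧ suc T) (∘-resp-≈ʳ (⟦suc⟧ʳ {n}))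

  ⟦++⟧ : ∀ {m} (A B : Sum m) → ⟦ A ++ₜ B ⟧Σ ≈ ⟦ A ⟧Σ + ⟦ B ⟧Σ
  ⟦++⟧ 0ₜ B = sym (+-identityˡ _)
  ⟦++⟧ (s +ₜ A) B = trans (+-cong refl (⟦++⟧ A B)) (sym (+-assoc _ _ _))

  ⟦ƛΣ⟧ : ∀ {m} (A : Sum (suc m)) → ⟦ ƛΣ A ⟧Σ ≈ abs ⟦ A ⟧Σ
  ⟦ƛΣ⟧ 0ₜ = sym abs-0
  ⟦ƛΣ⟧ (s +ₜ A) = trans (+-cong refl (⟦ƛΣ⟧ A)) (sym abs-+)

  ⟦appΣ⟧ : ∀ {m} (A V : Sum m) → ⟦ appΣ A V ⟧Σ ≈ app ⟦ A ⟧Σ ⟦ V ⟧Σ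
  ⟦appΣ⟧ 0ₜ V = sym app-0ˡ
  ⟦appΣ⟧ (s +ₜ A) V = trans (+-cong refl (⟦appΣ⟧ A V)) (sym app-+ˡ)

  ⟦DΣʳ⟧ : ∀ {m} (s : Simple m) (B : Sum m) → ⟦ DΣʳ s B ⟧Σ ≈ dapp ⟦ s ⟧ˢ ⟦ B ⟧Σ
  ⟦DΣʳ⟧ s 0ₜ = sym dapp-0ʳ
  ⟦DΣʳ⟧ s (t +ₜ B) = trans (+-cong refl (⟦DΣʳ⟧ s B)) (sym dapp-+ʳ)

  ⟦DΣ-single⟧ : ∀ {m} (A : Sum m) (u : Simple m) → ⟦ DΣ A (u +ₜ 0ₜ) ⟧Σ ≈ dapp ⟦ A ⟧Σ ⟦ u ⟧ˢ
  ⟦DΣ-single⟧ 0ₜ u = sym dapp-0ˡ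
  ⟦DΣ-single⟧ (s +ₜ A) u = begin
    ⟦ DΣʳ s (u +ₜ 0ₜ) ++ₜ DΣ A (u +ₜ 0ₜ) ⟧Σ ≈⟨ ⟦++⟧ (DΣʳ s (u +ₜ 0ₜ)) (DΣ A (u +ₜ 0ₜ)) ⟩
    (dapp ⟦ s ⟧ˢ ⟦ u ⟧ˢ + 0h) + ⟦ DΣ A (u +ₜ 0ₜ) ⟧Σ ≈⟨ +-cong (+-identityʳ _) (⟦DΣ-single⟧ A u) ⟩
    dapp ⟦ s ⟧ˢ ⟦ u ⟧ˢ + dapp ⟦ A ⟧Σ ⟦ u ⟧ˢ        ≈⟨ dapp-+ˡ ⟨
    dapp ⟦ s +ₜ A ⟧Σ ⟦ u ⟧ˢ                        ∎

  proj-linear : ∀ {m} (j : Fin m) → isLinear (proj j)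
  proj-linear zero = D3-π₂
  proj-linear (suc j) = ∘-linear (proj-linear j) D3-π₁

  record Along {m} (i : Fin m) (T : Sum m) (τ : Hom (U^ m) (U^ m)) : Set e where
    field
      along-i : proj i ∘ τ ≈ ⟦ T ⟧Σ
      along-other : ∀ {j} → j ≢ i → proj j ∘ τ ≈ 0h

  open Along

  Along-ƛ : ∀ {m} {i : Fin m} {T : Sum m} {τ : Hom (U^ m) (U^ m)} →
            Along i T τ → Along (suc i) (wkΣ T) (τ ⊗ 0h)
  Along-ƛ {T = T} a .along-i = trans (pullʳ project₁) (trans (pullˡ (along-i a)) (sym (⟦wkΣ⟧ T)))
  Along-ƛ a .along-other {zero} _ = trans project₂ (0-∘ π₂)
  Along-ƛ a .along-other {suc j} sj≢si =
    trans (pullʳ project₁) (trans (pullˡ (along-other a (λ j≡i → sj≢si (≡.cong suc j≡i)))) (0-∘ π₁))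

  Along-last : ∀ {n} (T : Sum n) → Along zero (wkΣ T) ⟨ 0h , ⟦ T ⟧Σ ∘ π₁ ⟩
  Along-last T .along-i = trans project₂ (sym (⟦wkΣ⟧ T))
  Along-last T .along-other {zero} 0≢0 with () ← 0≢0 ≡.refl
  Along-last T .along-other {suc j} _ = trans (pullʳ project₁) (linear-0 (proj-linear j))

  ⟦∂ˢ⟧ : ∀ {m} {i : Fin m} {T : Sum m} {τ : Hom (U^ m) (U^ m)} →
         Along i T τ → (s : Simple m) → ⟦ ∂ˢ i s T ⟧Σ ≈ D[ ⟦ s ⟧ˢ ∣ τ ]
  ⟦∂Σ⟧ : ∀ {m} {i : Fin m} {T : Sum m} {τ : Hom (U^ m) (U^ m)} →
         Along i T τ → (S : Sum m) → ⟦ ∂Σ i S T ⟧Σ ≈ D[ ⟦ S ⟧Σ ∣ τ ]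
  ⟦∂ˢ⟧ {i = i} a (var j) with j ≟ i
  ... | yes ≡.refl = sym (trans (linear-D∘ (proj-linear j)) (along-i a))
  ... | no j≢i = sym (trans (linear-D∘ (proj-linear j)) (along-other a j≢i))
  ⟦∂ˢ⟧ {i = i} {T} a (ƛ s) = begin
    ⟦ ƛΣ (∂ˢ (suc i) s (wkΣ T)) ⟧Σ ≈⟨ ⟦ƛΣ⟧ (∂ˢ (suc i) s (wkΣ T)) ⟩
    abs ⟦ ∂ˢ (suc i) s (wkΣ T) ⟧Σ  ≈⟨ abs-cong (⟦∂ˢ⟧ (Along-ƛ a) s) ⟩
    abs D[ ⟦ s ⟧ˢ ∣ _ ⊗ 0h ]       ≈⟨ D[abs] ⟨
    D[ abs ⟦ s ⟧ˢ ∣ _ ]            ∎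
  ⟦∂ˢ⟧ {i = i} {T} a (s · V) = begin
    ⟦ appΣ (∂ˢ i s T) V ++ₜ appΣ (DΣʳ s (∂Σ i V T)) V ⟧Σ
      ≈⟨ ⟦++⟧ (appΣ (∂ˢ i s T) V) (appΣ (DΣʳ s (∂Σ i V T)) V) ⟩
    ⟦ appΣ (∂ˢ i s T) V ⟧Σ + ⟦ appΣ (DΣʳ s (∂Σ i V T)) V ⟧Σ
      ≈⟨ +-cong (⟦appΣ⟧ (∂ˢ i s T) V) (trans (⟦appΣ⟧ (DΣʳ s (∂Σ i V T)) V) (app-cong (⟦DΣʳ⟧ s (∂Σ i V T)) refl)) ⟩
    app ⟦ ∂ˢ i s T ⟧Σ ⟦ V ⟧Σ + app (dapp ⟦ s ⟧ˢ ⟦ ∂Σ i V T ⟧Σ) ⟦ V ⟧Σ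
      ≈⟨ +-cong (app-cong (⟦∂ˢ⟧ a s) refl) (app-cong (dapp-cong refl (⟦∂Σ⟧ a V)) refl) ⟩
    app D[ ⟦ s ⟧ˢ ∣ _ ] ⟦ V ⟧Σ + app (dapp ⟦ s ⟧ˢ D[ ⟦ V ⟧Σ ∣ _ ]) ⟦ V ⟧Σ
      ≈⟨ D[app] ⟨
    D[ app ⟦ s ⟧ˢ ⟦ V ⟧Σ ∣ _ ] ∎
  ⟦∂ˢ⟧ {i = i} {T} a (D⟨ s ⟩ u) = begin
    ⟦ DΣ (∂ˢ i s T) (u +ₜ 0ₜ) ++ₜ DΣʳ s (∂ˢ i u T) ⟧Σ
      ≈⟨ ⟦++⟧ (DΣ (∂ˢ i s T) (u +ₜ 0ₜ)) (DΣʳ s (∂ˢ i u T)) ⟩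
    ⟦ DΣ (∂ˢ i s T) (u +ₜ 0ₜ) ⟧Σ + ⟦ DΣʳ s (∂ˢ i u T) ⟧Σ
      ≈⟨ +-cong (⟦DΣ-single⟧ (∂ˢ i s T) u) (⟦DΣʳ⟧ s (∂ˢ i u T)) ⟩
    dapp ⟦ ∂ˢ i s T ⟧Σ ⟦ u ⟧ˢ + dapp ⟦ s ⟧ˢ ⟦ ∂ˢ i u T ⟧Σ
      ≈⟨ +-cong (dapp-cong (⟦∂ˢ⟧ a s) refl) (dapp-cong refl (⟦∂ˢ⟧ a u)) ⟩
    dapp D[ ⟦ s ⟧ˢ ∣ _ ] ⟦ u ⟧ˢ + dapp ⟦ s ⟧ˢ D[ ⟦ u ⟧ˢ ∣ _ ]
      ≈⟨ D[dapp] ⟨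
    D[ dapp ⟦ s ⟧ˢ ⟦ u ⟧ˢ ∣ _ ] ∎
  ⟦∂Σ⟧ a 0ₜ = sym D[]-0
  ⟦∂Σ⟧ {i = i} {T} a (s +ₜ S) = begin
    ⟦ ∂ˢ i s T ++ₜ ∂Σ i S T ⟧Σ            ≈⟨ ⟦++⟧ (∂ˢ i s T) (∂Σ i S T) ⟩
    ⟦ ∂ˢ i s T ⟧Σ + ⟦ ∂Σ i S T ⟧Σ         ≈⟨ +-cong (⟦∂ˢ⟧ a s) (⟦∂Σ⟧ a S) ⟩
    D[ ⟦ s ⟧ˢ ∣ _ ] + D[ ⟦ S ⟧Σ ∣ _ ]     ≈⟨ D[]-+ ⟨
    D[ ⟦ s ⟧ˢ + ⟦ S ⟧Σ ∣ _ ]              ∎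

theorem4p10 : ∀ {o ℓ e} (𝒞 : CCDC o ℓ e) (𝒰 : LinearReflexive 𝒞) (n : ℕ)
    (S : Sum (suc n)) (T : Sum n) →
    CCDC._≈_ 𝒞 (Interpretation.⟦_⟧Σ 𝒞 𝒰 (∂Σ zero S (wkΣ T)))
      (CCDCNotation._⋆_ 𝒞 (Interpretation.⟦_⟧Σ 𝒞 𝒰 S) (Interpretation.⟦_⟧Σ 𝒞 𝒰 T))
theorem4p10 𝒞 𝒰 n S T = ⟦∂Σ⟧ (Along-last T) S
  where open Semantics 𝒞 𝒰
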